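{- Let $\mathcal D$ be a commutative variety of algebras or of ordered algebras, with its symmetric monoidal closed structure, and let $X,Y$ be objects of $\mathcal D$. Then every language $L:X^*\to Y$ admits a syntactic $\mathcal D$-monoid (with respect to the class of surjective homomorphisms).
   Context: A commutative variety $\mathcal D$ is a variety of (ordered) $\Sigma$-algebras, $\Sigma$ finitary, such that for all $A,B$ the set $[A,B]$ of homomorphisms is a subalgebra of $B^{|A|}$. Tensor product $A\otimes B$ represents bimorphisms (maps $|A|\times|B|\to|C|$ that are homomorphisms in each variable), $I$ is the free algebra on one generator. A $\mathcal D$-monoid is an object $M$ with a monoid structure $(|M|,\bullet,1)$ whose multiplication is a bimorphism; morphisms are homomorphisms preserving $\bullet$ and $1$. $X^*$ is the free $\mathcal D$-monoid on $X$; a language is a morphism $L:X^*\to Y$. A $\mathcal D$-monoid morphism $e:X^*\to M$ recognizes $L$ if $L=f\circ e$ for some morphism $f:M\to Y$ of $\mathcal D$. An $X$-generated $\mathcal D$-monoid is a surjective $\mathcal D$-monoid morphism $e:X^*\to M$; $e_1\le e_2$ iff $e_1=h\circ e_2$ for some $\mathcal D$-monoid morphism $h$. A syntactic $\mathcal D$-monoid of $L$ is an $X$-generated $\mathcal D$-monoid recognizing $L$ that is $\le$ every $X$-generated $\mathcal D$-monoid recognizing $L$. -}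

module Defs where

open import Level using (Level) renaming (suc to lsuc)
open import Data.Nat using (ℕ)
open import Data.Fin using (Fin)
open import Data.Unit.Polymorphic using (⊤)
open import Data.Product using (Σ; Σ-syntax; _×_; _,_; ∃)
open import Relation.Binary using (Rel; IsPartialOrder)

record Signature : Set₁ where
  field
    Op    : Set
    arity : Op → ℕ

open Signature public

data Term (S : Signature) (V : Set) : Set where
  var : V → Term S V
  op  : (o : Op S) → (Fin (arity S o) → Term S V) → Term S V

-- Ordered Σ-algebras (carrier a setoid with a partial order, monotone
-- operations).  Plain algebras are those whose order is discrete.

record Algebra (S : Signature) (ℓ : Level) : Set (lsuc ℓ) where
  field
    Carrier        : Set ℓ
    _≈_            : Rel Carrier ℓ
    _≤_            : Rel Carrier ℓ
    isPartialOrder : IsPartialOrder _≈_ _≤_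
    ⟦_⟧            : (o : Op S) → (Fin (arity S o) → Carrier) → Carrier
    ⟦⟧-mono        : ∀ o {xs ys : Fin (arity S o) → Carrier} →
                     (∀ i → xs i ≤ ys i) → ⟦ o ⟧ xs ≤ ⟦ o ⟧ ys

open Algebra public

eval : ∀ {S ℓ} (A : Algebra S ℓ) {V : Set} → (V → Carrier A) → Term S V → Carrier A
eval A ρ (var v)   = ρ v
eval A ρ (op o ts) = ⟦ A ⟧ o (λ i → eval A ρ (ts i))

record IsHom {S ℓ} (A B : Algebra S ℓ) (f : Carrier A → Carrier B) : Set ℓ where
  field
    mono     : ∀ {x y} → _≤_ A x y → _≤_ B (f x) (f y)
    preserve : ∀ o (xs : Fin (arity S o) → Carrier A) →
               _≈_ B (f (⟦ A ⟧ o xs)) (⟦ B ⟧ o (λ i → f (xs i)))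

record Hom {S ℓ} (A B : Algebra S ℓ) : Set ℓ where
  field
    fun   : Carrier A → Carrier B
    isHom : IsHom A B fun

open Hom public

data Kind : Set where
  plain ordered : Kind

-- For kind 'plain' the algebras are required to
-- be discretely ordered, so lhs ≤ rhs means lhs = rhs.
record Variety : Set₁ where
  field
    sig  : Signature
    kind : Kind
    Ax   : Set
    lhs  : Ax → Term sig ℕ
    rhs  : Ax → Term sig ℕ

open Variety public

KindOK : ∀ {S ℓ} → Kind → Algebra S ℓ → Set ℓ
KindOK plain   A = ∀ {x y} → _≤_ A x y → _≈_ A x y
KindOK ordered A = ⊤

record IsDAlg {ℓ} (D : Variety) (A : Algebra (sig D) ℓ) : Set ℓ where
  field
    kindOK   : KindOK (kind D) A
    satisfies : ∀ (e : Ax D) (ρ : ℕ → Carrier A) →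
                _≤_ A (eval A ρ (lhs D e)) (eval A ρ (rhs D e))

record DAlg (D : Variety) (ℓ : Level) : Set (lsuc ℓ) where
  field
    alg    : Algebra (sig D) ℓ
    isDAlg : IsDAlg D alg

open DAlg public

-- Commutative variety: for all A, B in D, [A,B] is closed under the
-- pointwise operations of B^{|A|}.
Commutative : (D : Variety) (ℓ : Level) → Set (lsuc ℓ)
Commutative D ℓ = ∀ (A B : DAlg D ℓ) (o : Op (sig D))
  (hs : Fin (arity (sig D) o) → Hom (alg A) (alg B)) →
  IsHom (alg A) (alg B) (λ a → ⟦ alg B ⟧ o (λ i → fun (hs i) a))

record DMonoid (D : Variety) (ℓ : Level) : Set (lsuc ℓ) where
  field
    dalg : DAlg D ℓ
  A : Algebra (sig D) ℓ
  A = alg dalg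
  field
    _•_     : Carrier A → Carrier A → Carrier A
    ε       : Carrier A
    assoc   : ∀ x y z → _≈_ A ((x • y) • z) (x • (y • z))
    identityˡ : ∀ x → _≈_ A (ε • x) x
    identityʳ : ∀ x → _≈_ A (x • ε) x
    •-homˡ  : ∀ b → IsHom A A (λ a → a • b)
    •-homʳ  : ∀ a → IsHom A A (λ b → a • b)

open DMonoid public using (dalg; _•_; ε)

algOf : ∀ {D ℓ} → DMonoid D ℓ → Algebra (sig D) ℓ
algOf M = alg (dalg M)

record MonHom {D ℓ} (M N : DMonoid D ℓ) : Set ℓ where
  field
    hom    : Hom (algOf M) (algOf N)
    pres-• : ∀ x y → _≈_ (algOf N) (fun hom (_•_ M x y))
                                  (_•_ N (fun hom x) (fun hom y))
    pres-ε : _≈_ (algOf N) (fun hom (ε M)) (ε N)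

open MonHom public

mfun : ∀ {D ℓ} {M N : DMonoid D ℓ} → MonHom M N → Carrier (algOf M) → Carrier (algOf N)
mfun h = fun (hom h)

IsFreeDMonoid : ∀ {D ℓ} (X : DAlg D ℓ) (F : DMonoid D ℓ) →
                Hom (alg X) (algOf F) → Set (lsuc ℓ)
IsFreeDMonoid {D} {ℓ} X F η = ∀ (M : DMonoid D ℓ) (g : Hom (alg X) (algOf M)) →
  Σ[ g' ∈ MonHom F M ]
    ((∀ x → _≈_ (algOf M) (mfun g' (fun η x)) (fun g x)) ×
     (∀ (k : MonHom F M) → (∀ x → _≈_ (algOf M) (mfun k (fun η x)) (fun g x)) →
        ∀ w → _≈_ (algOf M) (mfun k w) (mfun g' w)))

Surjective : ∀ {D ℓ} {M N : DMonoid D ℓ} → MonHom M N → Set ℓ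
Surjective {N = N} e = ∀ n → ∃ λ m → _≈_ (algOf N) (mfun e m) n

Recognizes : ∀ {D ℓ} {F M : DMonoid D ℓ} {Y : DAlg D ℓ} →
             MonHom F M → Hom (algOf F) (alg Y) → Set ℓ
Recognizes {M = M} {Y = Y} e L =
  Σ[ f ∈ Hom (algOf M) (alg Y) ] (∀ w → _≈_ (alg Y) (fun L w) (fun f (mfun e w)))

IsSyntactic : ∀ {D ℓ} {F : DMonoid D ℓ} {Y : DAlg D ℓ} (L : Hom (algOf F) (alg Y))
              (M : DMonoid D ℓ) (e : MonHom F M) → Set (lsuc ℓ)
IsSyntactic {D} {ℓ} {F} {Y} L M e =
  Surjective e × Recognizes {Y = Y} e L ×
  (∀ (M' : DMonoid D ℓ) (e' : MonHom F M') → Surjective e' → Recognizes {Y = Y} e' L →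
     Σ[ h ∈ MonHom M' M ] (∀ w → _≈_ (algOf M) (mfun e w) (mfun h (mfun e' w))))

HasSyntactic : ∀ {D ℓ} {F : DMonoid D ℓ} {Y : DAlg D ℓ} → Hom (algOf F) (alg Y) → Set (lsuc ℓ)
HasSyntactic {D} {ℓ} {F} {Y} L = Σ[ M ∈ DMonoid D ℓ ] Σ[ e ∈ MonHom F M ] IsSyntactic {Y = Y} L M e

module Submission where

-- The syntactic D-monoid of a language L : F → Y is the quotient of F by the
-- syntactic preorder  w ⊑ w'  ⇔  ∀ u v. L (u w v) ≤ L (u w' v).
--
-- The quotient keeps the
--     carrier and the operations of M and replaces the order by ≼; it is again
--     a D-monoid, the identity is a surjective morphism π : M → M/≼, maps that
--     are monotone for ≼ factor through π, and every surjective morphism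
--     e' : M → M' whose order-kernel lies below ≼ factors π.
--   * The syntactic preorder of L is admissible, L is monotone for it, and it
--     contains the order-kernel of every morphism recognising L.
-- Together these say that π is the syntactic D-monoid of L.  The argument
-- works for an arbitrary D-monoid F in place of X*.

open import Level using (Level) renaming (suc to lsuc)
open import Data.Nat using (ℕ)
open import Data.Fin using (Fin)
open import Data.Product using (Σ-syntax; _×_; _,_; proj₁; proj₂)
open import Data.Unit.Polymorphic using (tt)
open import Relation.Binary using (Rel; IsPartialOrder; Poset; Symmetric; Transitive)
open import Relation.Binary.PropositionalEquality using (_≡_; refl)
import Relation.Binary.Reasoning.PartialOrder as PosetReasoning
open import Defs

posetOf : ∀ {S ℓ} → Algebra S ℓ → Poset ℓ ℓ ℓ
posetOf A = record { isPartialOrder = isPartialOrder A }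

module OrderOf {S : Signature} {ℓ : Level} (A : Algebra S ℓ) where
  open Poset (posetOf A) public using (reflexive; antisym)
    renaming (refl to ≤-refl; trans to ≤-trans)
  open Poset.Eq (posetOf A) public using ()
    renaming (refl to ≈-refl; sym to ≈-sym; trans to ≈-trans)

  ⟦⟧-cong : ∀ o {xs ys : Fin (arity S o) → Carrier A} →
            (∀ i → _≈_ A (xs i) (ys i)) → _≈_ A (⟦ A ⟧ o xs) (⟦ A ⟧ o ys)
  ⟦⟧-cong o xs≈ys = antisym (⟦⟧-mono A o (λ i → reflexive (xs≈ys i)))
                            (⟦⟧-mono A o (λ i → reflexive (≈-sym (xs≈ys i))))

hom-cong : ∀ {S ℓ} {A B : Algebra S ℓ} {f : Carrier A → Carrier B} →
           IsHom A B f → ∀ {x y} → _≈_ A x y → _≈_ B (f x) (f y)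
hom-cong {A = A} {B} hf x≈y =
  OrderOf.antisym B (IsHom.mono hf (OrderOf.reflexive A x≈y))
                    (IsHom.mono hf (OrderOf.reflexive A (OrderOf.≈-sym A x≈y)))

∘-isHom : ∀ {S ℓ} {A B C : Algebra S ℓ} {f : Carrier A → Carrier B}
          {g : Carrier B → Carrier C} →
          IsHom A B f → IsHom B C g → IsHom A C (λ x → g (f x))
∘-isHom {C = C} hf hg = record
  { mono     = λ x≤y → IsHom.mono hg (IsHom.mono hf x≤y)
  ; preserve = λ o xs → OrderOf.≈-trans C (hom-cong hg (IsHom.preserve hf o xs))
                                          (IsHom.preserve hg o _)
  }

plain-discrete : ∀ {S ℓ} {k : Kind} {A : Algebra S ℓ} → KindOK k A → k ≡ plain →
                 ∀ {x y} → _≤_ A x y → _≈_ A x y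
plain-discrete discrete refl = discrete

-- A preorder on a D-monoid along which it can be quotiented.
record Admissible {D : Variety} {ℓ : Level} (M : DMonoid D ℓ) : Set (lsuc ℓ) where
  field
    _≼_      : Rel (Carrier (algOf M)) ℓ
    ≼-trans  : Transitive _≼_
    ≤⇒≼      : ∀ {x y} → _≤_ (algOf M) x y → x ≼ y
    ⟦⟧-monoᵖ : ∀ o {xs ys : Fin (arity (sig D) o) → Carrier (algOf M)} →
               (∀ i → xs i ≼ ys i) → ⟦ algOf M ⟧ o xs ≼ ⟦ algOf M ⟧ o ys
    •-monoˡ  : ∀ b {x y} → x ≼ y → _•_ M x b ≼ _•_ M y b
    •-monoʳ  : ∀ a {x y} → x ≼ y → _•_ M a x ≼ _•_ M a y
    plain⇒sym : kind D ≡ plain → Symmetric _≼_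

module Quotient {D : Variety} {ℓ : Level} {M : DMonoid D ℓ} (R : Admissible M) where
  open Admissible R
  private
    A = algOf M
    module A = OrderOf A

  _≋_ : Rel (Carrier A) ℓ
  x ≋ y = (x ≼ y) × (y ≼ x)

  ≼-refl : ∀ {x} → x ≼ x
  ≼-refl = ≤⇒≼ A.≤-refl

  ≈⇒≋ : ∀ {x y} → _≈_ A x y → x ≋ y
  ≈⇒≋ x≈y = ≤⇒≼ (A.reflexive x≈y) , ≤⇒≼ (A.reflexive (A.≈-sym x≈y))

  ≼-isPartialOrder : IsPartialOrder _≋_ _≼_
  ≼-isPartialOrder = record
    { isPreorder = record
      { isEquivalence = record
        { refl  = ≼-refl , ≼-refl
        ; sym   = λ { (x≼y , y≼x) → y≼x , x≼y }
        ; trans = λ { (x≼y , y≼x) (y≼z , z≼y) → ≼-trans x≼y y≼z , ≼-trans z≼y y≼x } }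
      ; reflexive = proj₁
      ; trans     = ≼-trans }
    ; antisym = _,_ }

  Q : Algebra (sig D) ℓ
  Q = record
    { Carrier        = Carrier A
    ; _≈_            = _≋_
    ; _≤_            = _≼_
    ; isPartialOrder = ≼-isPartialOrder
    ; ⟦_⟧            = ⟦ A ⟧
    ; ⟦⟧-mono        = ⟦⟧-monoᵖ }

  eval-Q : ∀ (ρ : ℕ → Carrier A) t → _≈_ A (eval Q ρ t) (eval A ρ t)
  eval-Q ρ (var v)   = A.≈-refl
  eval-Q ρ (op o ts) = A.⟦⟧-cong o (λ i → eval-Q ρ (ts i))

  -- Q lies in D: it satisfies the axioms because M does, and it is discrete
  -- for plain varieties by symmetry of ≼.
  kindOK-Q : (k : Kind) → (k ≡ plain → Symmetric _≼_) → KindOK k Q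
  kindOK-Q plain   sym x≼y = x≼y , sym refl x≼y
  kindOK-Q ordered _       = tt

  Q-isDAlg : IsDAlg D Q
  Q-isDAlg = record
    { kindOK    = kindOK-Q (kind D) plain⇒sym
    ; satisfies = λ ax ρ → ≤⇒≼ (A.≤-trans (A.reflexive (eval-Q ρ (lhs D ax)))
        (A.≤-trans (IsDAlg.satisfies (isDAlg (dalg M)) ax ρ)
                   (A.reflexive (A.≈-sym (eval-Q ρ (rhs D ax)))))) }

  M/≼ : DMonoid D ℓ
  M/≼ = record
    { dalg      = record { alg = Q ; isDAlg = Q-isDAlg }
    ; _•_       = _•_ M
    ; ε         = ε M
    ; assoc     = λ x y z → ≈⇒≋ (DMonoid.assoc M x y z)
    ; identityˡ = λ x → ≈⇒≋ (DMonoid.identityˡ M x)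
    ; identityʳ = λ x → ≈⇒≋ (DMonoid.identityʳ M x)
    ; •-homˡ    = λ b → record
        { mono = •-monoˡ b
        ; preserve = λ o xs → ≈⇒≋ (IsHom.preserve (DMonoid.•-homˡ M b) o xs) }
    ; •-homʳ    = λ a → record
        { mono = •-monoʳ a
        ; preserve = λ o xs → ≈⇒≋ (IsHom.preserve (DMonoid.•-homʳ M a) o xs) } }

  π : MonHom M M/≼
  π = record
    { hom    = record { fun = λ w → w
                      ; isHom = record { mono = ≤⇒≼ ; preserve = λ _ _ → ≼-refl , ≼-refl } }
    ; pres-• = λ _ _ → ≼-refl , ≼-refl
    ; pres-ε = ≼-refl , ≼-refl }

  π-surjective : Surjective π
  π-surjective w = w , ≼-refl , ≼-refl

  factor : ∀ {B : Algebra (sig D) ℓ} (f : Hom A B) →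
           (∀ {x y} → x ≼ y → _≤_ B (fun f x) (fun f y)) → Hom Q B
  factor f f-mono = record
    { fun   = fun f
    ; isHom = record { mono = f-mono ; preserve = IsHom.preserve (isHom f) } }

  -- A surjective morphism e' : M → M' whose order-kernel lies below ≼ factors
  -- π: choosing preimages along e' gives a morphism h with π = h ∘ e'.
  lift : ∀ (M' : DMonoid D ℓ) (e' : MonHom M M') → Surjective e' →
         (∀ {a b} → _≤_ (algOf M') (mfun e' a) (mfun e' b) → a ≼ b) →
         Σ[ h ∈ MonHom M' M/≼ ] (∀ w → mfun π w ≋ mfun h (mfun e' w))
  lift M' e' surj kernel = h , λ w → kernel≋ (M'.≈-sym (section (mfun e' w)))
    where
    module M' = OrderOf (algOf M')
    E = mfun e'
    _∙'_ = _•_ M'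

    kernel≋ : ∀ {a b} → _≈_ (algOf M') (E a) (E b) → a ≋ b
    kernel≋ Ea≈Eb = kernel (M'.reflexive Ea≈Eb) , kernel (M'.reflexive (M'.≈-sym Ea≈Eb))

    choose : Carrier (algOf M') → Carrier A
    choose m = proj₁ (surj m)

    section : ∀ m → _≈_ (algOf M') (E (choose m)) m
    section m = proj₂ (surj m)

    via-e' : ∀ {a b} m → _≈_ (algOf M') (E a) m → _≈_ (algOf M') m (E b) → a ≋ b
    via-e' m Ea≈m m≈Eb = kernel≋ (M'.≈-trans Ea≈m m≈Eb)

    h : MonHom M' M/≼
    h = record
      { hom = record
        { fun   = choose
        ; isHom = record
          { mono = λ {m} {m'} m≤m' → kernel (M'.≤-trans (M'.reflexive (section m))
                                       (M'.≤-trans m≤m' (M'.reflexive (M'.≈-sym (section m')))))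
          ; preserve = λ o ms → via-e' (⟦ algOf M' ⟧ o (λ i → E (choose (ms i))))
              (M'.≈-trans (section _) (M'.⟦⟧-cong o (λ i → M'.≈-sym (section (ms i)))))
              (M'.≈-sym (IsHom.preserve (isHom (hom e')) o (λ i → choose (ms i)))) } }
      ; pres-• = λ m n → via-e' (E (choose m) ∙' E (choose n))
          (M'.≈-trans (section (m ∙' n))
            (M'.≈-trans (hom-cong (DMonoid.•-homˡ M' n) (M'.≈-sym (section m)))
                        (hom-cong (DMonoid.•-homʳ M' (E (choose m))) (M'.≈-sym (section n)))))
          (M'.≈-sym (pres-• e' (choose m) (choose n)))
      ; pres-ε = via-e' (ε M') (section (ε M')) (M'.≈-sym (pres-ε e')) }

module Syntactic {D : Variety} {ℓ : Level} {Y : DAlg D ℓ} {F : DMonoid D ℓ}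
                 (L : Hom (algOf F) (alg Y)) where
  private
    A = algOf F
    B = alg Y
    module A = OrderOf A
    module B = OrderOf B
    _·_ = _•_ F
    infixl 7 _·_

  context-isHom : ∀ u v → IsHom A B (λ w → fun L ((u · w) · v))
  context-isHom u v =
    ∘-isHom (∘-isHom (DMonoid.•-homʳ F u) (DMonoid.•-homˡ F v)) (isHom L)

  _⊑_ : Rel (Carrier A) ℓ
  w ⊑ w' = ∀ u v → _≤_ B (fun L ((u · w) · v)) (fun L ((u · w') · v))

  regroupˡ : ∀ u w b v → _≈_ A ((u · (w · b)) · v) ((u · w) · (b · v))
  regroupˡ u w b v = A.≈-trans (hom-cong (DMonoid.•-homˡ F v) (A.≈-sym (DMonoid.assoc F u w b)))
                               (DMonoid.assoc F (u · w) b v)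

  regroupʳ : ∀ u b w v → _≈_ A ((u · (b · w)) · v) (((u · b) · w) · v)
  regroupʳ u b w v = hom-cong (DMonoid.•-homˡ F v) (A.≈-sym (DMonoid.assoc F u b w))

  transport : ∀ {w w' x x'} → _≈_ A w x → _≈_ A w' x' →
              _≤_ B (fun L x) (fun L x') → _≤_ B (fun L w) (fun L w')
  transport {w} {w'} {x} {x'} w≈x w'≈x' Lx≤Lx' = begin
    fun L w  ≈⟨ hom-cong (isHom L) w≈x ⟩
    fun L x  ≤⟨ Lx≤Lx' ⟩
    fun L x' ≈⟨ hom-cong (isHom L) w'≈x' ⟨
    fun L w' ∎
    where open PosetReasoning (posetOf B)

  ⊑-admissible : Admissible F
  ⊑-admissible = record
    { _≼_      = _⊑_
    ; ≼-trans  = λ w⊑w' w'⊑w'' u v → B.≤-trans (w⊑w' u v) (w'⊑w'' u v)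
    ; ≤⇒≼      = λ w≤w' u v → IsHom.mono (context-isHom u v) w≤w'
    ; ⟦⟧-monoᵖ = λ o {xs} {ys} xs⊑ys u v → begin
        fun L ((u · ⟦ A ⟧ o xs) · v)                 ≈⟨ IsHom.preserve (context-isHom u v) o xs ⟩
        ⟦ B ⟧ o (λ i → fun L ((u · xs i) · v))       ≤⟨ ⟦⟧-mono B o (λ i → xs⊑ys i u v) ⟩
        ⟦ B ⟧ o (λ i → fun L ((u · ys i) · v))       ≈⟨ IsHom.preserve (context-isHom u v) o ys ⟨
        fun L ((u · ⟦ A ⟧ o ys) · v)                 ∎
    ; •-monoˡ  = λ b w⊑w' u v → transport (regroupˡ u _ b v) (regroupˡ u _ b v) (w⊑w' u (b · v))
    ; •-monoʳ  = λ b w⊑w' u v → transport (regroupʳ u b _ v) (regroupʳ u b _ v) (w⊑w' (u · b) v)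
    ; plain⇒sym = λ isPlain w⊑w' u v →
        B.reflexive (B.≈-sym (plain-discrete (IsDAlg.kindOK (isDAlg Y)) isPlain (w⊑w' u v))) }
    where open PosetReasoning (posetOf B)

  open Quotient ⊑-admissible using (M/≼; π; π-surjective; factor; lift)

  -- L is monotone for ⊑: take the empty context.
  L-mono : ∀ {w w'} → w ⊑ w' → _≤_ B (fun L w) (fun L w')
  L-mono {w} {w'} w⊑w' = transport (A.≈-sym (empty w)) (A.≈-sym (empty w')) (w⊑w' (ε F) (ε F))
    where
    empty : ∀ x → _≈_ A ((ε F · x) · ε F) x
    empty x = A.≈-trans (hom-cong (DMonoid.•-homˡ F (ε F)) (DMonoid.identityˡ F x))
                        (DMonoid.identityʳ F x)

  π-recognizes : Recognizes {Y = Y} π L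
  π-recognizes = factor L L-mono , λ _ → B.≈-refl

  -- If L = f ∘ e', then e' a ≤ e' b implies a ⊑ b, since every context
  -- L (u _ v) factors through e' monotonically.
  recognizer-kernel : ∀ {M' : DMonoid D ℓ} (e' : MonHom F M') → Recognizes {Y = Y} e' L →
                      ∀ {a b} → _≤_ (algOf M') (mfun e' a) (mfun e' b) → a ⊑ b
  recognizer-kernel {M'} e' (f , L≈f∘e') {a} {b} Ea≤Eb u v = begin
    fun L ((u · a) · v)   ≈⟨ through-e' a ⟩
    fun f (in-context a)  ≤⟨ IsHom.mono (isHom f) (IsHom.mono (DMonoid.•-homˡ M' (E v))
                               (IsHom.mono (DMonoid.•-homʳ M' (E u)) Ea≤Eb)) ⟩
    fun f (in-context b)  ≈⟨ through-e' b ⟨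
    fun L ((u · b) · v)   ∎
    where
    open PosetReasoning (posetOf B)
    module M' = OrderOf (algOf M')
    E = mfun e'
    in-context : Carrier A → Carrier (algOf M')
    in-context w = _•_ M' (_•_ M' (E u) (E w)) (E v)
    through-e' : ∀ w → _≈_ B (fun L ((u · w) · v)) (fun f (in-context w))
    through-e' w = B.≈-trans (L≈f∘e' ((u · w) · v))
      (hom-cong (isHom f) (M'.≈-trans (pres-• e' (u · w) v)
                                      (hom-cong (DMonoid.•-homˡ M' (E v)) (pres-• e' u w))))

  syntactic : HasSyntactic {D} {ℓ} {F} {Y} L
  syntactic = M/≼ , π , π-surjective , π-recognizes ,
    λ M' e' surj recognizes → lift M' e' surj (recognizer-kernel e' recognizes)

corollary3p10 : ∀ {ℓ : Level} (D : Variety) → Commutative D ℓ →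
    (X Y : DAlg D ℓ) (Xstar : DMonoid D ℓ) (η : Hom (alg X) (algOf Xstar)) →
    IsFreeDMonoid X Xstar η →
    (L : Hom (algOf Xstar) (alg Y)) → HasSyntactic {D} {ℓ} {Xstar} {Y} L
corollary3p10 D _ _ Y Xstar _ _ L = Syntactic.syntactic {D} {Y = Y} {F = Xstar} L
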